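{- Let $G=(V,E)$ be a finite simple graph. Consider the procedure: set $\mathcal{F}=\emptyset$; while the integer program $\mathrm{MFF}(G,\mathcal{F})$ is feasible, choose an optimal solution $x$ of it and replace $\mathcal{F}$ by $\mathcal{F}\cup\{\{v\in V: x_v=1\}\}$; when $\mathrm{MFF}(G,\mathcal{F})$ is infeasible, return $\mathcal{F}$. Here $\mathrm{MFF}(G,\mathcal{F})$ is: minimize $\sum_{v\in V}x_v$ subject to $x\in\{0,1\}^V$, $\sum_{v\in V}x_v\ge1$, $x_u-x_v+\sum_{w\in N(u)\setminus\{v\}}x_w\ge0$ for all $v\in V$, $u\in N(v)$, and $\sum_{v\in F}x_v\le|F|-1$ for all $F\in\mathcal{F}$. Then the collection $\mathcal{F}$ returned by this procedure is the collection of all minimal forts of $G$.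
   Context: $N(u)$ is the neighborhood of $u$. A fort of $G$ is a non-empty set $F\subseteq V$ such that no vertex $u\in V\setminus F$ has exactly one neighbor in $F$. A fort is minimal if no fort of $G$ is a proper subset of it. -}

module Defs where

open import Data.Nat using (ℕ; _≤_)
open import Data.Bool using (Bool; true; false; if_then_else_)
open import Data.Integer as ℤ using (ℤ; +_; 0ℤ; 1ℤ)
open import Data.Fin using (Fin)
open import Data.Fin.Subset using (Subset; _∈_; _∉_; _⊂_; _∩_; _-_; ∣_∣; Nonempty)
open import Data.Vec using (lookup; tabulate)
open import Data.List using (List; _∷_)
open import Data.List.Relation.Unary.Any using (Any)
open import Data.Product using (Σ; _×_)
open import Relation.Binary.PropositionalEquality using (_≡_; _≢_)
open import Relation.Nullary using (¬_)

record Graph (n : ℕ) : Set where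
  field
    adj    : Fin n → Fin n → Bool
    sym    : ∀ u v → adj u v ≡ adj v u
    irrefl : ∀ v → adj v v ≡ false
open Graph public

module _ {n : ℕ} (G : Graph n) where

  N : Fin n → Subset n
  N u = tabulate (adj G u)

  Fort : Subset n → Set
  Fort F = Nonempty F × (∀ u → u ∉ F → ∣ N u ∩ F ∣ ≢ 1)

  MinimalFort : Subset n → Set
  MinimalFort F = Fort F × (∀ F′ → Fort F′ → ¬ (F′ ⊂ F))

  -- A 0/1 vector x ∈ {0,1}^V is represented by the subset {v : x_v = 1}.
  val : Subset n → Fin n → ℕ
  val x v = if lookup x v then 1 else 0

  Feasible : List (Subset n) → Subset n → Set
  Feasible 𝓕 x =
      (1 ≤ ∣ x ∣)
    × (∀ v u → u ∈ N v →
         0ℤ ℤ.≤ (+ val x u ℤ.- + val x v) ℤ.+ + ∣ (N u - v) ∩ x ∣)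
    × (∀ F → Any (F ≡_) 𝓕 →
         + ∣ F ∩ x ∣ ℤ.≤ + ∣ F ∣ ℤ.- 1ℤ)

  Optimal : List (Subset n) → Subset n → Set
  Optimal 𝓕 x = Feasible 𝓕 x × (∀ y → Feasible 𝓕 y → ∣ x ∣ ≤ ∣ y ∣)

  Infeasible : List (Subset n) → Set
  Infeasible 𝓕 = ¬ (Σ (Subset n) (Feasible 𝓕))

  Step : List (Subset n) → List (Subset n) → Set
  Step 𝓕 𝓕′ = Σ (Subset n) (λ x → Optimal 𝓕 x × 𝓕′ ≡ x ∷ 𝓕)

{-# OPTIONS --safe #-}

-- The feasible points of MFF(G, 𝓕) are exactly the forts containing no member of 𝓕: the
-- inequality for an edge u ∈ N(v) only bites when v ∈ x and u ∉ x, where it demands a second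
-- neighbour of u in x, and the inequality for F ∈ 𝓕 says F ⊈ x. A fort F′ ⊂ x inside an optimal
-- point x would again contain no member of 𝓕, so it would be feasible and smaller; hence x is a
-- minimal fort, and it is new because x ⊆ x. Every iteration therefore adds a new subset of V and
-- the procedure terminates. When MFF(G, 𝓕) is infeasible, a minimal fort F missing from 𝓕 would
-- be feasible, since a member of 𝓕 is a fort and so lies inside F only if it equals F.

module Submission where

open import Defs
open import Data.Bool using (true; false)
import Data.Bool as Bool
open import Data.Fin using (zero; suc)
open import Data.Fin.Subset using (Subset; _∈_; _∉_; _⊆_; _⊂_; _∩_; _─_; _-_; ⁅_⁆; ∣_∣; Nonempty)
open import Data.Fin.Subset.Properties
  using (_∈?_; nonempty?; Empty-unique; ∣⊥∣≡0; p─⊥≡p; ⊆-refl; ⊆-antisym; ⊆-trans;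
         p⊆q⇒∣p∣≤∣q∣; p⊂q⇒p⊆q; p⊂q⇒∣p∣<∣q∣; p∩q⊆p; x∈p∩q⁺; x∈p∩q⁻; x∈p⇒∣p-x∣<∣p∣)
open import Data.Integer as ℤ using (0ℤ; 1ℤ; +_; +≤+)
import Data.Integer.Properties as ℤ
open import Data.List using (List; []; _∷_; _++_; map; filter; length)
open import Data.List.Membership.Propositional using () renaming (_∈_ to _∈ₗ_; _∉_ to _∉ₗ_)
open import Data.List.Membership.Propositional.Properties using (∈-++⁺ˡ; ∈-++⁺ʳ; ∈-map⁺)
import Data.List.Membership.DecPropositional as DecMembership
open import Data.List.Relation.Unary.All as All using (All; []; _∷_)
open import Data.List.Relation.Unary.Any as Any using (Any; here; there)
open import Data.Nat using (ℕ)
import Data.Nat as ℕ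
import Data.Nat.Properties as ℕ
open import Data.Nat.Induction using (<-wellFounded)
open import Data.Product using (_×_; ∃-syntax; _,_; proj₁; proj₂)
open import Data.Vec using ([]; _∷_; lookup; there)
open import Data.Vec.Properties using (≡-dec; lookup∘tabulate; []=⇒lookup; lookup⇒[]=)
open import Function using (_∘_; flip)
open import Function.Bundles using (_⇔_; mk⇔; Equivalence)
open import Induction.WellFounded using (Acc; WellFounded; module Subrelation)
import Relation.Binary.Construct.On as On
open import Relation.Binary.Construct.Closure.ReflexiveTransitive using (Star; ε; _◅_)
open import Relation.Binary.Definitions using (DecidableEquality)
open import Relation.Binary.PropositionalEquality
  using (_≡_; _≢_; refl; trans; cong; cong₂; subst; subst₂; module ≡-Reasoning)
import Relation.Binary.PropositionalEquality as ≡
open import Relation.Nullary using (¬_; yes; no; contradiction)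
open import Relation.Unary as U using (Pred; Decidable)

module _ {a p} {A : Set a} {P Q : Pred A p}
         (P? : Decidable P) (Q? : Decidable Q) (P⊆Q : P U.⊆ Q) where

  length-filter-mono : ∀ xs → length (filter P? xs) ℕ.≤ length (filter Q? xs)
  length-filter-mono [] = ℕ.z≤n
  length-filter-mono (x ∷ xs) with P? x | Q? x
  ... | yes _  | yes _  = ℕ.s≤s (length-filter-mono xs)
  ... | yes px | no ¬qx = contradiction (P⊆Q px) ¬qx
  ... | no _   | yes _  = ℕ.m≤n⇒m≤1+n (length-filter-mono xs)
  ... | no _   | no _   = length-filter-mono xs

  length-filter-strictMono : ∀ {xs} → Any (Q U.∩ U.∁ P) xs →
                             length (filter P? xs) ℕ.< length (filter Q? xs)
  length-filter-strictMono {x ∷ xs} (here (qx , ¬px)) with P? x | Q? x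
  ... | yes px | _      = contradiction px ¬px
  ... | no _   | yes _  = ℕ.s≤s (length-filter-mono xs)
  ... | no _   | no ¬qx = contradiction qx ¬qx
  length-filter-strictMono {x ∷ xs} (there any) with P? x | Q? x
  ... | yes _  | yes _  = ℕ.s≤s (length-filter-strictMono any)
  ... | yes px | no ¬qx = contradiction (P⊆Q px) ¬qx
  ... | no _   | yes _  = ℕ.m≤n⇒m≤1+n (length-filter-strictMono any)
  ... | no _   | no _   = length-filter-strictMono any

FreshCons : ∀ {a} {A : Set a} → List A → List A → Set a
FreshCons ys′ ys = ∃[ y ] y ∉ₗ ys × ys′ ≡ y ∷ ys

module _ {a} {A : Set a} (_≟_ : DecidableEquality A)
         {xs : List A} (enumerates : ∀ x → x ∈ₗ xs) where

  open DecMembership _≟_ using (_∉?_)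

  unlisted : List A → ℕ
  unlisted ys = length (filter (_∉? ys) xs)

  freshCons⇒unlisted< : ∀ {ys′ ys} → FreshCons ys′ ys → unlisted ys′ ℕ.< unlisted ys
  freshCons⇒unlisted< {ys = ys} (y , y∉ys , refl) =
    length-filter-strictMono (_∉? y ∷ ys) (_∉? ys) (_∘ there)
      (Any.map (λ { refl → y∉ys , λ y∉ → y∉ (here refl) }) (enumerates y))

  freshCons-wellFounded : WellFounded (FreshCons {A = A})
  freshCons-wellFounded =
    Subrelation.wellFounded freshCons⇒unlisted< (On.wellFounded unlisted <-wellFounded)

subsets : ∀ n → List (Subset n)
subsets ℕ.zero    = [] ∷ []
subsets (ℕ.suc n) = map (true ∷_) (subsets n) ++ map (false ∷_) (subsets n)

∈-subsets : ∀ {n} (p : Subset n) → p ∈ₗ subsets n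
∈-subsets []         = here refl
∈-subsets (true ∷ p) = ∈-++⁺ˡ (∈-map⁺ (true ∷_) (∈-subsets p))
∈-subsets {ℕ.suc n} (false ∷ p) =
  ∈-++⁺ʳ (map (true ∷_) (subsets n)) (∈-map⁺ (false ∷_) (∈-subsets p))

∣p∣≡1+∣p-x∣ : ∀ {n} {p : Subset n} {x} → x ∈ p → ∣ p ∣ ≡ ℕ.suc ∣ p - x ∣
∣p∣≡1+∣p-x∣ {p = true ∷ p} {zero}  _ = cong (ℕ.suc ∘ ∣_∣) (≡.sym (p─⊥≡p p))
∣p∣≡1+∣p-x∣ {p = true ∷ p} {suc x} (there x∈p) = cong ℕ.suc (∣p∣≡1+∣p-x∣ x∈p)
∣p∣≡1+∣p-x∣ {p = false ∷ p} {suc x} (there x∈p) = ∣p∣≡1+∣p-x∣ x∈p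

[p─q]∩r≡[p∩r]─q : ∀ {n} (p q r : Subset n) → (p ─ q) ∩ r ≡ (p ∩ r) ─ q
[p─q]∩r≡[p∩r]─q [] [] [] = refl
[p─q]∩r≡[p∩r]─q (s ∷ p) (true ∷ q) (t ∷ r) = cong (false ∷_) ([p─q]∩r≡[p∩r]─q p q r)
[p─q]∩r≡[p∩r]─q (s ∷ p) (false ∷ q) (t ∷ r) = cong (s Bool.∧ t ∷_) ([p─q]∩r≡[p∩r]─q p q r)

∣p∩q∣≡1+∣[p-x]∩q∣ : ∀ {n} {p q : Subset n} {x} → x ∈ p ∩ q → ∣ p ∩ q ∣ ≡ ℕ.suc ∣ (p - x) ∩ q ∣
∣p∩q∣≡1+∣[p-x]∩q∣ {p = p} {q} {x} x∈p∩q =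
  trans (∣p∣≡1+∣p-x∣ x∈p∩q) (cong (ℕ.suc ∘ ∣_∣) (≡.sym ([p─q]∩r≡[p∩r]─q p ⁅ x ⁆ q)))

module _ {n : ℕ} where

  nonempty⇔∣p∣>0 : ∀ {p : Subset n} → Nonempty p ⇔ 0 ℕ.< ∣ p ∣
  nonempty⇔∣p∣>0 {p} = mk⇔ (λ (x , x∈p) → ℕ.<-≤-trans ℕ.z<s (x∈p⇒∣p-x∣<∣p∣ x∈p)) from
    where
    from : 0 ℕ.< ∣ p ∣ → Nonempty p
    from ∣p∣>0 with nonempty? p
    ... | yes ne = ne
    ... | no ¬ne = contradiction (trans (cong ∣_∣ (Empty-unique ¬ne)) (∣⊥∣≡0 n)) (ℕ.>⇒≢ ∣p∣>0)

  ∣p∣≤∣p∩q∣⇒p⊆q : ∀ {p q : Subset n} → ∣ p ∣ ℕ.≤ ∣ p ∩ q ∣ → p ⊆ q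
  ∣p∣≤∣p∩q∣⇒p⊆q {p} {q} ∣p∣≤∣p∩q∣ {x} x∈p with x ∈? q
  ... | yes x∈q = x∈q
  ... | no x∉q  = contradiction ∣p∣≤∣p∩q∣ (ℕ.<⇒≱ (p⊂q⇒∣p∣<∣q∣ p∩q⊂p))
    where
    p∩q⊂p : p ∩ q ⊂ p
    p∩q⊂p = p∩q⊆p p q , x , x∈p , x∉q ∘ proj₂ ∘ x∈p∩q⁻ p q

  ∣p∩q∣<∣p∣⇔p⊈q : ∀ {p q : Subset n} → ∣ p ∩ q ∣ ℕ.< ∣ p ∣ ⇔ (¬ p ⊆ q)
  ∣p∩q∣<∣p∣⇔p⊈q = mk⇔
    (λ ∣p∩q∣<∣p∣ p⊆q → ℕ.<⇒≱ ∣p∩q∣<∣p∣ (p⊆q⇒∣p∣≤∣q∣ (λ x∈p → x∈p∩q⁺ (x∈p , p⊆q x∈p))))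
    (ℕ.≰⇒> ∘ (_∘ ∣p∣≤∣p∩q∣⇒p⊆q))

  ⊆∧⊄⇒≡ : ∀ {p q : Subset n} → p ⊆ q → ¬ p ⊂ q → p ≡ q
  ⊆∧⊄⇒≡ {p} {q} p⊆q p⊄q = ⊆-antisym p⊆q q⊆p
    where
    q⊆p : q ⊆ p
    q⊆p {x} x∈q with x ∈? p
    ... | yes x∈p = x∈p
    ... | no x∉p  = contradiction ((λ {y} → p⊆q {y}) , x , x∈q , x∉p) p⊄q

0≤[m-n]+k⇔n≤m+k : ∀ m n k → 0ℤ ℤ.≤ (+ m ℤ.- + n) ℤ.+ + k ⇔ n ℕ.≤ m ℕ.+ k
0≤[m-n]+k⇔n≤m+k m n k = mk⇔
  (λ 0≤ → ℤ.drop‿+≤+ (ℤ.0≤i-j⇒j≤i (subst (0ℤ ℤ.≤_) reassoc 0≤)))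
  (λ n≤m+k → subst (0ℤ ℤ.≤_) (≡.sym reassoc) (ℤ.i≤j⇒0≤j-i (+≤+ n≤m+k)))
  where
  open ≡-Reasoning
  reassoc : (+ m ℤ.- + n) ℤ.+ + k ≡ + (m ℕ.+ k) ℤ.- + n
  reassoc = begin
    (+ m ℤ.- + n) ℤ.+ + k  ≡⟨ cong (ℤ._+ + k) (ℤ.[+m]-[+n]≡m⊖n m n) ⟩
    (m ℤ.⊖ n) ℤ.+ + k      ≡⟨ ℤ.distribˡ-⊖-+-pos k m n ⟩
    (m ℕ.+ k) ℤ.⊖ n        ≡⟨ ℤ.[+m]-[+n]≡m⊖n (m ℕ.+ k) n ⟨
    + (m ℕ.+ k) ℤ.- + n    ∎

m≤n-1⇔m<n : ∀ m n → + m ℤ.≤ + n ℤ.- 1ℤ ⇔ m ℕ.< n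
m≤n-1⇔m<n m ℕ.zero    = mk⇔ (λ ()) (λ ())
m≤n-1⇔m<n m (ℕ.suc n) = mk⇔ (λ { (+≤+ m≤n) → ℕ.s≤s m≤n }) (λ { (ℕ.s≤s m≤n) → +≤+ m≤n })

open Equivalence using (to; from)

module _ {n : ℕ} (G : Graph n) where

  ∈N-sym : ∀ {u v} → u ∈ N G v → v ∈ N G u
  ∈N-sym {u} {v} u∈Nv = lookup⇒[]= v (N G u) (begin
    lookup (N G u) v  ≡⟨ lookup∘tabulate (adj G u) v ⟩
    adj G u v         ≡⟨ Graph.sym G u v ⟩
    adj G v u         ≡⟨ lookup∘tabulate (adj G v) u ⟨
    lookup (N G v) u  ≡⟨ []=⇒lookup u∈Nv ⟩
    true              ∎)
    where open ≡-Reasoning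

  val-∈ : ∀ {x v} → v ∈ x → val G x v ≡ 1
  val-∈ v∈x rewrite []=⇒lookup v∈x = refl

  val-∉ : ∀ {x v} → v ∉ x → val G x v ≡ 0
  val-∉ {x} {v} v∉x with lookup x v in eq
  ... | true  = contradiction (lookup⇒[]= v x eq) v∉x
  ... | false = refl

  NoLoneNeighbour : Subset n → Set
  NoLoneNeighbour x = ∀ u → u ∉ x → ∣ N G u ∩ x ∣ ≢ 1

  EdgeConstraints : Subset n → Set
  EdgeConstraints x = ∀ v u → u ∈ N G v → val G x v ℕ.≤ val G x u ℕ.+ ∣ (N G u - v) ∩ x ∣

  ContainsNoneOf : List (Subset n) → Subset n → Set
  ContainsNoneOf 𝓕 x = ∀ F → F ∈ₗ 𝓕 → ¬ F ⊆ x

  noLoneNeighbour⇒edgeConstraints : ∀ {x} → NoLoneNeighbour x → EdgeConstraints x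
  noLoneNeighbour⇒edgeConstraints {x} noLone v u u∈Nv with v ∈? x | u ∈? x
  ... | no v∉x  | _      rewrite val-∉ v∉x = ℕ.z≤n
  ... | yes v∈x | yes u∈x rewrite val-∈ v∈x | val-∈ u∈x = ℕ.s≤s ℕ.z≤n
  ... | yes v∈x | no u∉x  rewrite val-∈ v∈x | val-∉ u∉x =
    ℕ.n≢0⇒n>0 (λ others≡0 → noLone u u∉x
      (trans (∣p∩q∣≡1+∣[p-x]∩q∣ (x∈p∩q⁺ (∈N-sym u∈Nv , v∈x))) (cong ℕ.suc others≡0)))

  edgeConstraints⇒noLoneNeighbour : ∀ {x} → EdgeConstraints x → NoLoneNeighbour x
  edgeConstraints⇒noLoneNeighbour {x} edges u u∉x one
    with v , v∈Nu∩x ← from nonempty⇔∣p∣>0 (subst (0 ℕ.<_) (≡.sym one) ℕ.z<s) = contradiction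
      (subst₂ ℕ._≤_ (val-∈ v∈x) (cong₂ ℕ._+_ (val-∉ u∉x) others≡0) (edges v u (∈N-sym v∈Nu)))
      (λ ())
    where
    v∈Nu : v ∈ N G u
    v∈Nu = proj₁ (x∈p∩q⁻ (N G u) x v∈Nu∩x)
    v∈x : v ∈ x
    v∈x = proj₂ (x∈p∩q⁻ (N G u) x v∈Nu∩x)
    others≡0 : ∣ (N G u - v) ∩ x ∣ ≡ 0
    others≡0 = ℕ.suc-injective (trans (≡.sym (∣p∩q∣≡1+∣[p-x]∩q∣ v∈Nu∩x)) one)

  feasible⇔ : ∀ {𝓕 x} → Feasible G 𝓕 x ⇔ (Fort G x × ContainsNoneOf 𝓕 x)
  feasible⇔ = mk⇔
    (λ (∣x∣>0 , edges , forbidden) →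
      (from nonempty⇔∣p∣>0 ∣x∣>0 ,
       edgeConstraints⇒noLoneNeighbour λ v u u∈Nv → to (0≤[m-n]+k⇔n≤m+k _ _ _) (edges v u u∈Nv)) ,
      λ F F∈𝓕 → to ∣p∩q∣<∣p∣⇔p⊈q (to (m≤n-1⇔m<n _ _) (forbidden F F∈𝓕)))
    (λ ((nonempty , noLone) , avoids) →
      to nonempty⇔∣p∣>0 nonempty ,
      (λ v u u∈Nv →
        from (0≤[m-n]+k⇔n≤m+k _ _ _) (noLoneNeighbour⇒edgeConstraints noLone v u u∈Nv)) ,
      λ F F∈𝓕 → from (m≤n-1⇔m<n _ _) (from ∣p∩q∣<∣p∣⇔p⊈q (avoids F F∈𝓕)))

  feasible⇒∉ : ∀ {𝓕 x} → Feasible G 𝓕 x → x ∉ₗ 𝓕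
  feasible⇒∉ feasible x∈𝓕 = proj₂ (to feasible⇔ feasible) _ x∈𝓕 ⊆-refl

  optimal⇒minimalFort : ∀ {𝓕 x} → Optimal G 𝓕 x → MinimalFort G x
  optimal⇒minimalFort (feasible , minimum) =
    let (fort , avoids) = to feasible⇔ feasible in
    fort , λ F′ fortF′ F′⊂x → ℕ.<⇒≱ (p⊂q⇒∣p∣<∣q∣ F′⊂x) (minimum F′ (from feasible⇔
      (fortF′ , λ F F∈𝓕 F⊆F′ → avoids F F∈𝓕 (⊆-trans F⊆F′ (p⊂q⇒p⊆q F′⊂x)))))

  step⇒freshCons : ∀ {𝓕 𝓕′} → Step G 𝓕 𝓕′ → FreshCons 𝓕′ 𝓕
  step⇒freshCons (x , (feasible , _) , refl) = x , feasible⇒∉ feasible , refl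

  step-wellFounded : WellFounded (flip (Step G))
  step-wellFounded =
    Subrelation.wellFounded step⇒freshCons (freshCons-wellFounded (≡-dec Bool._≟_) ∈-subsets)

  reachable⇒minimalForts : ∀ {𝓕₀ 𝓕} → Star (Step G) 𝓕₀ 𝓕 →
                           All (MinimalFort G) 𝓕₀ → All (MinimalFort G) 𝓕
  reachable⇒minimalForts ε minimalForts = minimalForts
  reachable⇒minimalForts ((_ , optimal , refl) ◅ steps) minimalForts =
    reachable⇒minimalForts steps (optimal⇒minimalFort optimal ∷ minimalForts)

  open DecMembership (≡-dec {n = n} Bool._≟_) using () renaming (_∈?_ to _∈ₗ?_)

  infeasible⇒minimalFort∈ : ∀ {𝓕 F} → All (MinimalFort G) 𝓕 → Infeasible G 𝓕 →
                            MinimalFort G F → F ∈ₗ 𝓕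
  infeasible⇒minimalFort∈ {𝓕} {F} minimalForts infeasible (fort , minimal) with F ∈ₗ? 𝓕
  ... | yes F∈𝓕 = F∈𝓕
  ... | no F∉𝓕  = contradiction (F , from feasible⇔ (fort , avoids)) infeasible
    where
    avoids : ContainsNoneOf 𝓕 F
    avoids F₀ F₀∈𝓕 F₀⊆F = F∉𝓕 (subst (_∈ₗ 𝓕)
      (⊆∧⊄⇒≡ F₀⊆F (minimal F₀ (proj₁ (All.lookup minimalForts F₀∈𝓕)))) F₀∈𝓕)

corollary6p3 : ∀ {n : ℕ} (G : Graph n) →
  Acc (flip (Step G)) []
  × (∀ (𝓕 : List (Subset n)) → Star (Step G) [] 𝓕 → Infeasible G 𝓕 →
       ∀ (F : Subset n) → (Any (F ≡_) 𝓕 ⇔ MinimalFort G F))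
corollary6p3 G = step-wellFounded G [] , λ 𝓕 reachable infeasible F →
  let minimalForts = reachable⇒minimalForts G reachable [] in
  mk⇔ (All.lookup minimalForts) (infeasible⇒minimalFort∈ G minimalForts infeasible)
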